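{- For any placement of the stockpiles and any feasible schedule of the single reclaimer that reclaims the stockpiles in order $1,2,\dots,n$, the makespan $C$ satisfies $$C\ge P+\min_{0\le k\le n}\left|P^k-\overline P^k\right|/s.$$
   Context: Single-reclaimer positioning problem with precedence. Two pads $P_1,P_2$ are each modeled as $[0,L]$, $L$ a positive integer. Given stockpile lengths $p_j\in\mathbb{Z}$, $0<p_j\le L$, $j=1,\dots,n$, a placement chooses for each stockpile a pad and an interval $[l_j,r_j]\subseteq[0,L]$ with $r_j-l_j=p_j$, stockpiles on the same pad non-overlapping. Only reclaimer $R_0$ works, on a rail represented by $[0,L]$, starting and ending at $0$; reclaim speed $1$, travel speed $s\ge1$; its schedule is a continuous piecewise linear $H_0:[0,C]\to[0,L]$, $H_0(0)=H_0(C)=0$, with slopes in $\{0,\pm s,\pm1\}$ (slope $\pm1$ = reclaiming on either pad). Each stockpile is reclaimed by traversing all of $[l_j,r_j]$ once at speed $1$ in either direction, and the reclaiming of stockpile $j+1$ starts only after that of stockpile $j$ is finished. Notation: $P=p_1+\cdots+p_n$, $P^k=\sum_{i=1}^kp_i$, $\overline P^k=\sum_{i=k+1}^np_i$.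
   Formalization: The travel speed $s$, the stockpile positions $l_j$ and the durations of the linear pieces of the schedule $H_0$ are rational. -}

module Defs where

open import Data.Nat as ℕ using (ℕ; zero; suc; ∣_-_∣)
open import Data.Integer using (+_)
open import Data.Rational as ℚ using (ℚ; 0ℚ; _+_; _-_; _*_; _≤_; _/_; _÷_)
open import Data.Fin using (Fin)
open import Data.Nat.ListAction using (sum)
open import Data.List using (List; []; _∷_; map; take; drop; allFin; upTo; foldr)
open import Data.Product using (_×_)
open import Relation.Binary.PropositionalEquality using (_≡_; _≢_)
open import Relation.Nullary using (¬_)
open import Data.Sum using (_⊎_)

toℚ : ℕ → ℚ
toℚ n = + n / 1

-- Instance data: n stockpile lengths p : Fin n → ℕ (index i ↔ stockpile i+1)

Ptot : (n : ℕ) → (Fin n → ℕ) → ℕ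
Ptot n p = sum (map p (allFin n))

Pre : (n : ℕ) → (Fin n → ℕ) → ℕ → ℕ
Pre n p k = sum (take k (map p (allFin n)))

Suf : (n : ℕ) → (Fin n → ℕ) → ℕ → ℕ
Suf n p k = sum (drop k (map p (allFin n)))

minGap : (n : ℕ) → (Fin n → ℕ) → ℕ
minGap n p = foldr (λ k acc → gap k ℕ.⊓ acc) (gap 0) (upTo (suc n))
  where gap : ℕ → ℕ
        gap k = ∣ Pre n p k - Suf n p k ∣

record Placement (n L : ℕ) (p : Fin n → ℕ) : Set where
  field
    pad     : Fin n → Fin 2
    l       : Fin n → ℚ
    l≥0     : ∀ j → 0ℚ ≤ l j
    r≤L     : ∀ j → l j + toℚ (p j) ≤ toℚ L
    disjoint : ∀ i j → i ≢ j → pad i ≡ pad j →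
               (l i + toℚ (p i) ≤ l j) ⊎ (l j + toℚ (p j) ≤ l i)

-- Schedules of the reclaimer R0: a continuous piecewise linear function
-- H0 described by its consecutive linear pieces.

data Dir : Set where
  up down : Dir

data Piece (n : ℕ) : Set where
  wait   : ℚ → Piece n          -- slope 0 for the given duration
  travel : Dir → ℚ → Piece n    -- slope +s / -s for the given duration
  reclaim : Fin n → Dir → Piece n
    -- slope +1 / -1 traversing the whole stockpile j (duration p j)

dur : ∀ {n} → (Fin n → ℕ) → Piece n → ℚ
dur p (wait d) = d
dur p (travel _ d) = d
dur p (reclaim j _) = toℚ (p j)

makespan : ∀ {n} → (Fin n → ℕ) → List (Piece n) → ℚ
makespan p [] = 0ℚ
makespan p (x ∷ xs) = dur p x + makespan p xs

reclaimOrder : ∀ {n} → List (Piece n) → List (Fin n)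
reclaimOrder [] = []
reclaimOrder (wait _ ∷ xs) = reclaimOrder xs
reclaimOrder (travel _ _ ∷ xs) = reclaimOrder xs
reclaimOrder (reclaim j _ ∷ xs) = j ∷ reclaimOrder xs

Feasible : ∀ {n L p} → Placement n L p → (s : ℚ) → ℚ → List (Piece n) → Set
Feasible pl s x [] = x ≡ 0ℚ
Feasible {L = L} pl s x (wait d ∷ xs) = 0ℚ ≤ d × Feasible pl s x xs
Feasible {L = L} pl s x (travel up d ∷ xs) =
  0ℚ ≤ d × x + s * d ≤ toℚ L × Feasible pl s (x + s * d) xs
Feasible {L = L} pl s x (travel down d ∷ xs) =
  0ℚ ≤ d × 0ℚ ≤ x - s * d × Feasible pl s (x - s * d) xs
Feasible {p = p} pl s x (reclaim j up ∷ xs) =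
  x ≡ Placement.l pl j × Feasible pl s (x + toℚ (p j)) xs
Feasible {p = p} pl s x (reclaim j down ∷ xs) =
  x ≡ Placement.l pl j + toℚ (p j) × Feasible pl s (x - toℚ (p j)) xs

{-# OPTIONS --safe #-}
-- Cut the schedule where the reclaimer is farthest from the origin, at position M: the first part a
-- runs from 0 to M and the second part b from M back to 0; if a reclaims stockpiles 1..k, then b
-- reclaims k+1..n.  At each level z of the rail count the moves of the reclaimer crossing z.  For
-- 0 ≤ z < M each part crosses z an odd number of times, and at most two stockpiles (one per pad)
-- lie over z; hence the reclaiming crossings of a are at most those of b plus all travelling
-- crossings, and vice versa.  Integrating over z gives |P^k − P̄^k| ≤ s · (travel time), while the
-- makespan is P plus the travel time plus a nonnegative waiting time.
module Submission where

open import Defs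
open import Data.Bool using (if_then_else_)
open import Data.Fin as Fin using (Fin)
import Data.Fin.Properties as Fin
import Data.Integer as ℤ
import Data.Integer.Properties as ℤ
import Data.Nat.Coprimality as Coprime
open import Data.Nat as ℕ using (ℕ; zero; suc; z≤n; s≤s)
import Data.Nat.Properties as ℕ
open import Data.Nat.ListAction using (sum)
open import Data.Nat.ListAction.Properties using (sum-++)
open import Data.List using (List; []; _∷_; _++_; map; allFin; foldl; foldr; scanl; upTo; take; drop; length)
open import Data.List.Properties using (map-++; map-cong; foldl-++; length-map; length-tabulate; length-++-≤ˡ)
open import Data.List.Membership.Propositional using (_∈_)
open import Data.List.Membership.Propositional.Properties using (∈-++⁺ˡ; ∈-++⁺ʳ; ∈-upTo⁺)
open import Data.List.Relation.Binary.Permutation.Propositional using (↭-sym)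
open import Data.List.Relation.Binary.Permutation.Propositional.Properties using (∈-resp-↭)
open import Data.List.Relation.Unary.All as All using (All; []; _∷_)
open import Data.List.Relation.Unary.All.Properties using (++⁻ˡ; ++⁻ʳ)
open import Data.List.Relation.Unary.Any using (here; there)
open import Data.List.Relation.Unary.Linked using (Linked; []; [-]; _∷_)
open import Data.List.Relation.Unary.Unique.Propositional using (Unique; []; _∷_)
open import Data.List.Relation.Unary.Unique.Propositional.Properties using (allFin⁺)
open import Data.Product as Product using (_×_; _,_; proj₁; proj₂; ∃; ∃₂)
open import Data.Rational
  using (ℚ; mkℚ; 0ℚ; 1ℚ; _+_; _-_; _*_; -_; 1/_; _÷_; _≤_; _<_; *≤*; _≤?_; _<?_; ∣_∣; NonZero; positive; nonNegative)
open import Data.Rational.Properties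
open import Data.Rational.Solver using (module +-*-Solver)
open import Data.Sum using (_⊎_; inj₁; inj₂; [_,_]′)
open import Function using (_∘_)
open import Relation.Binary.PropositionalEquality
open import Relation.Nullary using (Dec; yes; no; does; ¬_; contradiction)
open import Relation.Nullary.Decidable using (_×-dec_)
open import Relation.Unary using (Decidable)

open import Algebra.Properties.CommutativeSemigroup ℕ.+-commutativeSemigroup
  using (interchange; xy∙z≈xz∙y; xy∙z≈x∙zy; x∙yz≈y∙xz)
open +-*-Solver using (solve; _:=_; _:+_; _:-_; _:*_; :-_; con)

toℚ≡mkℚ : ∀ n → toℚ n ≡ mkℚ (ℤ.+ n) 0 (Coprime.sym (Coprime.1-coprimeTo n))
toℚ≡mkℚ n = normalize-coprime _

toℚ-+ : ∀ m n → toℚ (m ℕ.+ n) ≡ toℚ m + toℚ n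
toℚ-+ m n = begin
  ℤ.+ (m ℕ.+ n) / 1
    ≡⟨ cong (_/ 1) (sym (cong₂ ℤ._+_ (ℤ.*-identityʳ (ℤ.+ m)) (ℤ.*-identityʳ (ℤ.+ n)))) ⟩
  (ℤ.+ m ℤ.* ℤ.+ 1 ℤ.+ ℤ.+ n ℤ.* ℤ.+ 1) / 1
    -- mkℚ (+ m) 0 _ + mkℚ (+ n) 0 _ unfolds to the line above by the definition of _+_
    ≡⟨ cong₂ _+_ (toℚ≡mkℚ m) (toℚ≡mkℚ n) ⟨
  toℚ m + toℚ n                             ∎
  where
  open ≡-Reasoning
  open Data.Rational using (_/_)

toℚ-mono-≤ : ∀ {m n} → m ℕ.≤ n → toℚ m ≤ toℚ n
toℚ-mono-≤ {m} {n} m≤n = subst₂ _≤_ (sym (toℚ≡mkℚ m)) (sym (toℚ≡mkℚ n))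
  (*≤* (ℤ.*-monoʳ-≤-nonNeg (ℤ.+ 1) (ℤ.+≤+ m≤n)))

0≤toℚ : ∀ n → 0ℚ ≤ toℚ n
0≤toℚ n = toℚ-mono-≤ {0} {n} z≤n

p≤q⇒0≤q-p : ∀ {p q} → p ≤ q → 0ℚ ≤ q - p
p≤q⇒0≤q-p {p} {q} p≤q = begin
  0ℚ     ≡⟨ +-inverseʳ p ⟨
  p - p  ≤⟨ +-monoˡ-≤ (- p) p≤q ⟩
  q - p  ∎
  where open ≤-Reasoning

p≤p+q : ∀ p {q} → 0ℚ ≤ q → p ≤ p + q
p≤p+q p {q} 0≤q = begin
  p       ≡⟨ +-identityʳ p ⟨
  p + 0ℚ  ≤⟨ +-monoʳ-≤ p 0≤q ⟩
  p + q   ∎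
  where open ≤-Reasoning

p-q≤p : ∀ p {q} → 0ℚ ≤ q → p - q ≤ p
p-q≤p p {q} 0≤q = begin
  p - q   ≤⟨ +-monoʳ-≤ p (neg-antimono-≤ 0≤q) ⟩
  p - 0ℚ  ≡⟨ +-identityʳ p ⟩
  p       ∎
  where open ≤-Reasoning

p+q-q≡p : ∀ p q → (p + q) - q ≡ p
p+q-q≡p = solve 2 (λ p q → (p :+ q) :- q := p) refl

+-cancelʳ-≤ : ∀ r {p q} → p + r ≤ q + r → p ≤ q
+-cancelʳ-≤ r {p} {q} p+r≤q+r = begin
  p            ≡⟨ p+q-q≡p p r ⟨
  (p + r) - r  ≤⟨ +-monoˡ-≤ (- r) p+r≤q+r ⟩
  (q + r) - r  ≡⟨ p+q-q≡p q r ⟩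
  q            ∎
  where open ≤-Reasoning

toℚ-∸-≤ : ∀ {m n t} → n ℕ.≤ m → toℚ m ≤ t + toℚ n → toℚ (m ℕ.∸ n) ≤ t
toℚ-∸-≤ {m} {n} {t} n≤m m≤t+n = +-cancelʳ-≤ (toℚ n) (subst (_≤ t + toℚ n) toℚm≡ m≤t+n)
  where toℚm≡ = trans (cong toℚ (sym (ℕ.m∸n+n≡m n≤m))) (toℚ-+ (m ℕ.∸ n) n)

toℚ-∣-∣≤ : ∀ {m n t} → toℚ m ≤ t + toℚ n → toℚ n ≤ t + toℚ m → toℚ ℕ.∣ m - n ∣ ≤ t
toℚ-∣-∣≤ {m} {n} m≤t+n n≤t+m with ℕ.≤-total n m
... | inj₁ n≤m = subst (λ k → toℚ k ≤ _) (sym (ℕ.m≤n⇒∣n-m∣≡n∸m n≤m)) (toℚ-∸-≤ n≤m m≤t+n)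
... | inj₂ m≤n = subst (λ k → toℚ k ≤ _) (sym (ℕ.m≤n⇒∣m-n∣≡n∸m m≤n)) (toℚ-∸-≤ m≤n n≤t+m)

÷-≤ : ∀ {p q} r .{{_ : NonZero r}} → 0ℚ < r → p ≤ r * q → p ÷ r ≤ q
÷-≤ {p} {q} r 0<r p≤rq = *-cancelˡ-≤-pos r {{positive 0<r}} (subst (_≤ r * q) (sym r*[p÷r]≡p) p≤rq)
  where
  r*[p÷r]≡p : r * (p ÷ r) ≡ p
  r*[p÷r]≡p = begin
    r * (p * 1/ r)    ≡⟨ cong (r *_) (*-comm p (1/ r)) ⟩
    r * (1/ r * p)    ≡⟨ *-assoc r (1/ r) p ⟨
    (r * 1/ r) * p    ≡⟨ cong (_* p) (*-inverseʳ r) ⟩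
    1ℚ * p            ≡⟨ *-identityˡ p ⟩
    p                 ∎
    where open ≡-Reasoning

sum-map-+ : ∀ {A : Set} (f g : A → ℕ) xs → sum (map (λ x → f x ℕ.+ g x) xs) ≡ sum (map f xs) ℕ.+ sum (map g xs)
sum-map-+ f g [] = refl
sum-map-+ f g (x ∷ xs) = trans (cong (f x ℕ.+ g x ℕ.+_) (sum-map-+ f g xs)) (interchange (f x) (g x) _ _)

+-telescope : ∀ a a′ b b′ {x y w} → a ℕ.+ x ≡ a′ ℕ.+ y → b ℕ.+ y ≡ b′ ℕ.+ w →
              (a ℕ.+ b) ℕ.+ x ≡ (a′ ℕ.+ b′) ℕ.+ w
+-telescope a a′ b b′ {x} {y} {w} h₁ h₂ = begin
  (a ℕ.+ b) ℕ.+ x     ≡⟨ xy∙z≈xz∙y a b x ⟩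
  (a ℕ.+ x) ℕ.+ b     ≡⟨ cong (ℕ._+ b) h₁ ⟩
  (a′ ℕ.+ y) ℕ.+ b    ≡⟨ xy∙z≈x∙zy a′ y b ⟩
  a′ ℕ.+ (b ℕ.+ y)    ≡⟨ cong (a′ ℕ.+_) h₂ ⟩
  a′ ℕ.+ (b′ ℕ.+ w)   ≡⟨ ℕ.+-assoc a′ b′ w ⟨
  (a′ ℕ.+ b′) ℕ.+ w   ∎
  where open ≡-Reasoning

Odd : ℕ → Set
Odd m = ∃ λ k → m ≡ suc (2 ℕ.* k)

odd-sum : ∀ {m n} → m ℕ.+ 1 ≡ n ℕ.+ 0 → Odd (m ℕ.+ n)
odd-sum {m} {n} m+1≡n+0 = m , (begin
  m ℕ.+ n          ≡⟨ cong (m ℕ.+_) n≡1+m ⟩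
  m ℕ.+ suc m      ≡⟨ ℕ.+-suc m m ⟩
  suc (m ℕ.+ m)    ≡⟨ cong (λ k → suc (m ℕ.+ k)) (ℕ.+-identityʳ m) ⟨
  suc (2 ℕ.* m)    ∎)
  where
  open ≡-Reasoning
  n≡1+m = trans (sym (ℕ.+-identityʳ n)) (trans (sym m+1≡n+0) (ℕ.+-comm m 1))

-- At one level: rᵢ and tᵢ count the reclaiming and the travelling crossings of the two parts.
-- If r₂ = 0 the second part must travel across; r₁ = 2 with t₁ = 0 is excluded by parity.
crossing-bound : ∀ r₁ r₂ {t₁ t₂} → r₁ ℕ.+ r₂ ℕ.≤ 2 → Odd (r₁ ℕ.+ t₁) → Odd (r₂ ℕ.+ t₂) →
                 r₁ ℕ.≤ (t₁ ℕ.+ t₂) ℕ.+ r₂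
crossing-bound zero _ _ _ _ = z≤n
crossing-bound (suc zero) zero {t₁} {t₂} _ _ (_ , odd₂) =
  ℕ.≤-trans (subst (1 ℕ.≤_) (sym odd₂) (s≤s z≤n)) (ℕ.≤-trans (ℕ.m≤n+m t₂ t₁) (ℕ.m≤m+n (t₁ ℕ.+ t₂) 0))
crossing-bound (suc (suc zero)) zero {zero} _ (k₁ , odd₁) _ =
  contradiction (ℕ.m*n≡1⇒m≡1 2 k₁ (sym (ℕ.suc-injective odd₁))) λ ()
crossing-bound (suc (suc zero)) zero {suc t₁} {t₂} _ _ (_ , odd₂) =
  ℕ.≤-trans (ℕ.+-mono-≤ (s≤s (z≤n {t₁})) (subst (1 ℕ.≤_) (sym odd₂) (s≤s z≤n)))
            (ℕ.m≤m+n (suc t₁ ℕ.+ t₂) 0)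
crossing-bound (suc zero) (suc r₂) _ _ _ = ℕ.≤-trans (s≤s z≤n) (ℕ.m≤n+m (suc r₂) _)
crossing-bound (suc (suc zero)) (suc (suc r₂)) _ _ _ = ℕ.≤-trans (s≤s (s≤s z≤n)) (ℕ.m≤n+m (suc (suc r₂)) _)
crossing-bound (suc (suc zero)) (suc zero) (s≤s (s≤s ())) _ _
crossing-bound (suc (suc (suc _))) _ (s≤s (s≤s ())) _ _

𝟙 : ∀ {A : Set} → Dec A → ℕ
𝟙 d = if does d then 1 else 0

𝟙-yes : ∀ {A : Set} (d : Dec A) → A → 𝟙 d ≡ 1
𝟙-yes (yes _) _ = refl
𝟙-yes (no ¬a) a = contradiction a ¬a

𝟙-no : ∀ {A : Set} (d : Dec A) → ¬ A → 𝟙 d ≡ 0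
𝟙-no (yes a) ¬a = contradiction a ¬a
𝟙-no (no _) _ = refl

module _ {A : Set} {P : A → Set} (P? : Decidable P) where

  sum-𝟙≡0 : ∀ {xs} → All (¬_ ∘ P) xs → sum (map (𝟙 ∘ P?) xs) ≡ 0
  sum-𝟙≡0 [] = refl
  sum-𝟙≡0 {x ∷ _} (¬px ∷ ¬Ps) = cong₂ ℕ._+_ (𝟙-no (P? x) ¬px) (sum-𝟙≡0 ¬Ps)

  sum-𝟙≤1 : ∀ {xs} → Unique xs → (∀ {x y} → P x → P y → x ≡ y) → sum (map (𝟙 ∘ P?) xs) ℕ.≤ 1
  sum-𝟙≤1 [] _ = z≤n
  sum-𝟙≤1 {x ∷ xs} (x∉xs ∷ unique) P-unique = go (P? x)
    where
    go : (d : Dec (P x)) → 𝟙 d ℕ.+ sum (map (𝟙 ∘ P?) xs) ℕ.≤ 1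
    go (yes px) = ℕ.≤-reflexive (cong suc (sum-𝟙≡0 (All.map (λ x≢y py → x≢y (P-unique px py)) x∉xs)))
    go (no _) = sum-𝟙≤1 unique P-unique

𝟙-split-Fin2 : ∀ {X : Set} (k : Fin 2) (d : Dec X) →
               𝟙 d ≡ 𝟙 ((k Fin.≟ Fin.zero) ×-dec d) ℕ.+ 𝟙 ((k Fin.≟ Fin.suc Fin.zero) ×-dec d)
𝟙-split-Fin2 Fin.zero d = sym (ℕ.+-identityʳ (𝟙 d))
𝟙-split-Fin2 (Fin.suc Fin.zero) d = refl

between : ℚ → ℚ → ℚ → ℕ
between a b z = 𝟙 ((a ≤? z) ×-dec (z <? b))

between-≡0 : ∀ a b z → ¬ (a ≤ z × z < b) → between a b z ≡ 0
between-≡0 a b z = 𝟙-no ((a ≤? z) ×-dec (z <? b))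

between-≡1 : ∀ a b z → a ≤ z → z < b → between a b z ≡ 1
between-≡1 a b z a≤z z<b = 𝟙-yes ((a ≤? z) ×-dec (z <? b)) (a≤z , z<b)

between-empty : ∀ a b z → b ≤ a → between a b z ≡ 0
between-empty a b z b≤a = between-≡0 a b z (λ (a≤z , z<b) → <-irrefl refl (<-≤-trans z<b (≤-trans b≤a a≤z)))

Sorted : List ℚ → Set
Sorted = Linked _≤_

head≤ : ∀ {e E z} → Sorted (e ∷ E) → z ∈ e ∷ E → e ≤ z
head≤ _ (here refl) = ≤-refl
head≤ (e≤e′ ∷ sorted) (there z∈E) = ≤-trans e≤e′ (head≤ sorted z∈E)

∈-tail : ∀ {e E z} → e < z → z ∈ e ∷ E → z ∈ E
∈-tail e<z (here refl) = contradiction e<z (<-irrefl refl)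
∈-tail _ (there z∈E) = z∈E

-- ∫ f E integrates the step function equal to f e on [e , e′), for consecutive breakpoints e, e′ of E.
∫ : (ℚ → ℕ) → List ℚ → ℚ
∫ f (e ∷ e′ ∷ E) = toℚ (f e) * (e′ - e) + ∫ f (e′ ∷ E)
∫ f _ = 0ℚ

∫-+ : ∀ f g E → ∫ (λ z → f z ℕ.+ g z) E ≡ ∫ f E + ∫ g E
∫-+ f g [] = sym (+-identityʳ 0ℚ)
∫-+ f g (e ∷ []) = sym (+-identityʳ 0ℚ)
∫-+ f g (e ∷ E@(e′ ∷ _)) = begin
  toℚ (f e ℕ.+ g e) * (e′ - e) + ∫ (λ z → f z ℕ.+ g z) E
    ≡⟨ cong₂ (λ x y → x * (e′ - e) + y) (toℚ-+ (f e) (g e)) (∫-+ f g E) ⟩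
  (toℚ (f e) + toℚ (g e)) * (e′ - e) + (∫ f E + ∫ g E)
    ≡⟨ solve 5 (λ a b d x y → (a :+ b) :* d :+ (x :+ y) := (a :* d :+ x) :+ (b :* d :+ y)) refl
         (toℚ (f e)) (toℚ (g e)) (e′ - e) (∫ f E) (∫ g E) ⟩
  (toℚ (f e) * (e′ - e) + ∫ f E) + (toℚ (g e) * (e′ - e) + ∫ g E) ∎
  where open ≡-Reasoning

∫-≡0 : ∀ f E → (∀ {z} → z ∈ E → f z ≡ 0) → ∫ f E ≡ 0ℚ
∫-≡0 f [] _ = refl
∫-≡0 f (e ∷ []) _ = refl
∫-≡0 f (e ∷ E@(e′ ∷ _)) f≡0 = begin
  toℚ (f e) * (e′ - e) + ∫ f E
    ≡⟨ cong₂ (λ i w → toℚ i * (e′ - e) + w) (f≡0 (here refl)) (∫-≡0 f E (f≡0 ∘ there)) ⟩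
  0ℚ * (e′ - e) + 0ℚ
    ≡⟨ solve 1 (λ d → con 0ℚ :* d :+ con 0ℚ := con 0ℚ) refl (e′ - e) ⟩
  0ℚ ∎
  where open ≡-Reasoning

∫-mono : ∀ f g {E} → Sorted E → (∀ z → f z ℕ.≤ g z) → ∫ f E ≤ ∫ g E
∫-mono f g [] _ = ≤-refl
∫-mono f g [-] _ = ≤-refl
∫-mono f g {e ∷ e′ ∷ E} (e≤e′ ∷ sorted) f≤g =
  +-mono-≤ (*-monoʳ-≤-nonNeg (e′ - e) {{nonNegative (p≤q⇒0≤q-p e≤e′)}} (toℚ-mono-≤ (f≤g e)))
           (∫-mono f g sorted f≤g)

∫-between-from-head : ∀ {a b e E} → Sorted (e ∷ E) → b ∈ e ∷ E → a ≤ e → ∫ (between a b) (e ∷ E) ≡ b - e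
∫-between-from-head {b = b} {E = []} _ (here refl) _ = sym (+-inverseʳ b)
∫-between-from-head {a} {b} {e} {e′ ∷ E} (e≤e′ ∷ sorted) b∈ a≤e with e <? b
... | yes e<b = begin
  toℚ (between a b e) * (e′ - e) + ∫ (between a b) (e′ ∷ E)
    ≡⟨ cong₂ (λ i w → toℚ i * (e′ - e) + w) (between-≡1 a b e a≤e e<b)
             (∫-between-from-head sorted (∈-tail e<b b∈) (≤-trans a≤e e≤e′)) ⟩
  1ℚ * (e′ - e) + (b - e′)
    ≡⟨ solve 3 (λ b e e′ → con 1ℚ :* (e′ :- e) :+ (b :- e′) := b :- e) refl b e e′ ⟩
  b - e ∎
  where open ≡-Reasoning
... | no e≮b = begin
  ∫ (between a b) (e ∷ e′ ∷ E)
    ≡⟨ ∫-≡0 (between a b) (e ∷ e′ ∷ E)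
         (λ {z} z∈ → between-≡0 a b z (λ (_ , z<b) → e≮b (≤-<-trans (head≤ sorted′ z∈) z<b))) ⟩
  0ℚ     ≡⟨ +-inverseʳ b ⟨
  b - b  ≡⟨ cong (λ x → b - x) (≤-antisym (≮⇒≥ e≮b) (head≤ sorted′ b∈)) ⟩
  b - e  ∎
  where
  open ≡-Reasoning
  sorted′ = e≤e′ ∷ sorted

∫-between : ∀ {a b E} → Sorted E → a ∈ E → b ∈ E → a ≤ b → ∫ (between a b) E ≡ b - a
∫-between {a} {b} {e ∷ E} sorted a∈ b∈ a≤b with e <? a
... | no e≮a =
  subst (λ x → ∫ (between a b) (e ∷ E) ≡ b - x) (sym a≡e) (∫-between-from-head sorted b∈ (≤-reflexive a≡e))
  where a≡e = ≤-antisym (≮⇒≥ e≮a) (head≤ sorted a∈)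
... | yes e<a with E | sorted | ∈-tail e<a a∈
...   | e′ ∷ E′ | _ ∷ sorted′ | a∈E = begin
  toℚ (between a b e) * (e′ - e) + ∫ (between a b) (e′ ∷ E′)
    ≡⟨ cong₂ (λ i w → toℚ i * (e′ - e) + w) (between-≡0 a b e (λ (a≤e , _) → <-irrefl refl (<-≤-trans e<a a≤e)))
             (∫-between sorted′ a∈E (∈-tail (<-≤-trans e<a a≤b) b∈) a≤b) ⟩
  0ℚ * (e′ - e) + (b - a)
    ≡⟨ solve 2 (λ d x → con 0ℚ :* d :+ x := x) refl (e′ - e) (b - a) ⟩
  b - a ∎
  where open ≡-Reasoning

∫-between-≥ : ∀ {a b} E → b ≤ a → ∫ (between a b) E ≡ 0ℚ
∫-between-≥ {a} {b} E b≤a = ∫-≡0 (between a b) E (λ {z} _ → between-empty a b z b≤a)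

-- A segment (u , v) is a move from u to v.  It crosses each level of the half-open interval
-- between u and v once: upward if u < v, downward if v < u.
Segment : Set
Segment = ℚ × ℚ

upCross downCross covers : Segment → ℚ → ℕ
upCross (u , v) = between u v
downCross (u , v) = between v u
covers g z = upCross g z ℕ.+ downCross g z

segLength : Segment → ℚ
segLength (u , v) = ∣ v - u ∣

segLength-ascending : ∀ x {q} → 0ℚ ≤ q → segLength (x , x + q) ≡ q
segLength-ascending x {q} 0≤q = trans (cong ∣_∣ (solve 2 (λ x q → (x :+ q) :- x := q) refl x q)) (0≤p⇒∣p∣≡p 0≤q)

segLength-descending : ∀ x {q} → 0ℚ ≤ q → segLength (x , x - q) ≡ q
segLength-descending x {q} 0≤q = begin
  ∣ (x - q) - x ∣  ≡⟨ cong ∣_∣ (solve 2 (λ x q → (x :- q) :- x := :- q) refl x q) ⟩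
  ∣ - q ∣          ≡⟨ ∣-p∣≡∣p∣ q ⟩
  ∣ q ∣            ≡⟨ 0≤p⇒∣p∣≡p 0≤q ⟩
  q                ∎
  where open ≡-Reasoning

segment-balance : ∀ u v z → upCross (u , v) z ℕ.+ 𝟙 (z <? u) ≡ downCross (u , v) z ℕ.+ 𝟙 (z <? v)
segment-balance u v z = go (z <? u) (z <? v)
  where
  up≡0 : z < u → between u v z ≡ 0
  up≡0 z<u = between-≡0 u v z (λ (u≤z , _) → <-irrefl refl (<-≤-trans z<u u≤z))
  down≡0 : z < v → between v u z ≡ 0
  down≡0 z<v = between-≡0 v u z (λ (v≤z , _) → <-irrefl refl (<-≤-trans z<v v≤z))
  go : (z<u? : Dec (z < u)) (z<v? : Dec (z < v)) → between u v z ℕ.+ 𝟙 z<u? ≡ between v u z ℕ.+ 𝟙 z<v?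
  go (yes z<u) (yes z<v) = cong (ℕ._+ 1) (trans (up≡0 z<u) (sym (down≡0 z<v)))
  go (yes z<u) (no z≮v) = trans (cong (ℕ._+ 1) (up≡0 z<u)) (sym (cong (ℕ._+ 0) (between-≡1 v u z (≮⇒≥ z≮v) z<u)))
  go (no z≮u) (yes z<v) = trans (cong (ℕ._+ 0) (between-≡1 u v z (≮⇒≥ z≮u) z<v)) (sym (cong (ℕ._+ 1) (down≡0 z<v)))
  go (no z≮u) (no z≮v) = cong (ℕ._+ 0) (trans (between-≡0 u v z (λ (_ , z<v) → z≮v z<v))
                                              (sym (between-≡0 v u z (λ (_ , z<u) → z≮u z<u))))

upCrossings downCrossings crossings : List Segment → ℚ → ℕ
upCrossings gs z = sum (map (λ g → upCross g z) gs)
downCrossings gs z = sum (map (λ g → downCross g z) gs)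
crossings gs z = sum (map (λ g → covers g z) gs)

crossings≡up+down : ∀ gs z → crossings gs z ≡ upCrossings gs z ℕ.+ downCrossings gs z
crossings≡up+down gs z = sum-map-+ (λ g → upCross g z) (λ g → downCross g z) gs

crossings-++ : ∀ gs hs z → crossings (gs ++ hs) z ≡ crossings gs z ℕ.+ crossings hs z
crossings-++ gs hs z = trans (cong sum (map-++ (λ g → covers g z) gs hs)) (sum-++ (map (λ g → covers g z) gs) _)

Within : ℚ → ℚ → ℚ → Set
Within lo hi y = lo ≤ y × y ≤ hi

crossings-outside : ∀ {lo hi z} gs → All (λ (u , v) → Within lo hi u × Within lo hi v) gs →
                    z < lo ⊎ hi ≤ z → crossings gs z ≡ 0
crossings-outside [] _ _ = refl
crossings-outside {lo} {hi} {z} ((u , v) ∷ gs) ((u-in , v-in) ∷ gs-in) z-out =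
  cong₂ ℕ._+_ (cong₂ ℕ._+_ (outside u-in v-in) (outside v-in u-in)) (crossings-outside gs gs-in z-out)
  where
  outside : ∀ {a b} → Within lo hi a → Within lo hi b → between a b z ≡ 0
  outside {a} {b} (lo≤a , _) (_ , b≤hi) = between-≡0 a b z (λ (a≤z , z<b) →
    [ (λ z<lo → <-irrefl refl (<-≤-trans z<lo (≤-trans lo≤a a≤z)))
    , (λ hi≤z → <-irrefl refl (<-≤-trans z<b (≤-trans b≤hi hi≤z))) ]′ z-out)

totalLength : List Segment → ℚ
totalLength [] = 0ℚ
totalLength (g ∷ gs) = segLength g + totalLength gs

totalLength-++ : ∀ gs hs → totalLength (gs ++ hs) ≡ totalLength gs + totalLength hs
totalLength-++ [] hs = sym (+-identityˡ _)
totalLength-++ (g ∷ gs) hs = trans (cong (segLength g +_) (totalLength-++ gs hs)) (sym (+-assoc (segLength g) _ _))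

∫-covers : ∀ {u v E} → Sorted E → u ∈ E → v ∈ E → ∫ (covers (u , v)) E ≡ segLength (u , v)
∫-covers {u} {v} {E} sorted u∈ v∈ with ≤-total u v
... | inj₁ u≤v = begin
  ∫ (covers (u , v)) E                    ≡⟨ ∫-+ (between u v) (between v u) E ⟩
  ∫ (between u v) E + ∫ (between v u) E   ≡⟨ cong₂ _+_ (∫-between sorted u∈ v∈ u≤v) (∫-between-≥ E u≤v) ⟩
  (v - u) + 0ℚ                            ≡⟨ +-identityʳ (v - u) ⟩
  v - u                                   ≡⟨ 0≤p⇒∣p∣≡p (p≤q⇒0≤q-p u≤v) ⟨
  ∣ v - u ∣                               ∎
  where open ≡-Reasoning
... | inj₂ v≤u = begin
  ∫ (covers (u , v)) E                    ≡⟨ ∫-+ (between u v) (between v u) E ⟩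
  ∫ (between u v) E + ∫ (between v u) E   ≡⟨ cong₂ _+_ (∫-between-≥ E v≤u) (∫-between sorted v∈ u∈ v≤u) ⟩
  0ℚ + (u - v)                            ≡⟨ +-identityˡ (u - v) ⟩
  u - v                                   ≡⟨ 0≤p⇒∣p∣≡p (p≤q⇒0≤q-p v≤u) ⟨
  ∣ u - v ∣                               ≡⟨ ∣-p∣≡∣p∣ (u - v) ⟨
  ∣ - (u - v) ∣                           ≡⟨ cong ∣_∣ (solve 2 (λ u v → :- (u :- v) := v :- u) refl u v) ⟩
  ∣ v - u ∣                               ∎
  where open ≡-Reasoning

∫-crossings : ∀ {E} gs → Sorted E → (∀ {u v} → (u , v) ∈ gs → u ∈ E × v ∈ E) →
              ∫ (crossings gs) E ≡ totalLength gs
∫-crossings {E} [] _ _ = ∫-≡0 (crossings []) E (λ _ → refl)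
∫-crossings {E} (g@(u , v) ∷ gs) sorted ends∈ = begin
  ∫ (λ z → covers g z ℕ.+ crossings gs z) E
    ≡⟨ ∫-+ (covers g) (crossings gs) E ⟩
  ∫ (covers g) E + ∫ (crossings gs) E
    ≡⟨ cong₂ _+_ (∫-covers sorted u∈ v∈) (∫-crossings gs sorted (ends∈ ∘ there)) ⟩
  segLength g + totalLength gs ∎
  where
  open ≡-Reasoning
  u∈ = proj₁ (ends∈ (here refl))
  v∈ = proj₂ (ends∈ (here refl))

endpoints : List Segment → List ℚ
endpoints [] = []
endpoints ((u , v) ∷ gs) = u ∷ v ∷ endpoints gs

∈-endpoints : ∀ {u v gs} → (u , v) ∈ gs → u ∈ endpoints gs × v ∈ endpoints gs
∈-endpoints (here refl) = here refl , there (here refl)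
∈-endpoints {gs = _ ∷ _} (there g∈) = Product.map (there ∘ there) (there ∘ there) (∈-endpoints g∈)

totalLength-mono : ∀ gs hs → (∀ z → crossings gs z ℕ.≤ crossings hs z) → totalLength gs ≤ totalLength hs
totalLength-mono gs hs gs≤hs = begin
  totalLength gs      ≡⟨ ∫-crossings gs sorted (Product.map (∈E ∘ ∈-++⁺ˡ) (∈E ∘ ∈-++⁺ˡ) ∘ ∈-endpoints) ⟨
  ∫ (crossings gs) E  ≤⟨ ∫-mono (crossings gs) (crossings hs) sorted gs≤hs ⟩
  ∫ (crossings hs) E  ≡⟨ ∫-crossings hs sorted (Product.map (∈E ∘ ∈-++⁺ʳ _) (∈E ∘ ∈-++⁺ʳ _) ∘ ∈-endpoints) ⟩
  totalLength hs      ∎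
  where
  open ≤-Reasoning
  open import Data.List.Sort ≤-decTotalOrder using (sort; sort-↭; sort-↗)
  E = sort (endpoints gs ++ endpoints hs)
  sorted = sort-↗ (endpoints gs ++ endpoints hs)
  ∈E : ∀ {x} → x ∈ endpoints gs ++ endpoints hs → x ∈ E
  ∈E = ∈-resp-↭ (↭-sym (sort-↭ _))

totalLength-≤-+ : ∀ gs hs ks → (∀ z → crossings gs z ℕ.≤ crossings hs z ℕ.+ crossings ks z) →
                  totalLength gs ≤ totalLength hs + totalLength ks
totalLength-≤-+ gs hs ks gs≤hs+ks = begin
  totalLength gs
    ≤⟨ totalLength-mono gs (hs ++ ks) (λ z → subst (crossings gs z ℕ.≤_) (sym (crossings-++ hs ks z)) (gs≤hs+ks z)) ⟩
  totalLength (hs ++ ks)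
    ≡⟨ totalLength-++ hs ks ⟩
  totalLength hs + totalLength ks ∎
  where open ≤-Reasoning

module _ {n L : ℕ} {p : Fin n → ℕ} (pl : Placement n L p) where
  open Placement pl

  occupies : ℚ → Fin n → ℕ
  occupies z j = between (l j) (l j + toℚ (p j)) z

  occupancy≤2 : ∀ z → sum (map (occupies z) (allFin n)) ℕ.≤ 2
  occupancy≤2 z = begin
    sum (map (occupies z) (allFin n))
      ≡⟨ cong sum (map-cong (λ j → 𝟙-split-Fin2 (pad j) (occupied? j)) (allFin n)) ⟩
    sum (map (λ j → 𝟙 (onPad? Fin.zero j) ℕ.+ 𝟙 (onPad? (Fin.suc Fin.zero) j)) (allFin n))
      ≡⟨ sum-map-+ (𝟙 ∘ onPad? Fin.zero) (𝟙 ∘ onPad? (Fin.suc Fin.zero)) (allFin n) ⟩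
    sum (map (𝟙 ∘ onPad? Fin.zero) (allFin n)) ℕ.+ sum (map (𝟙 ∘ onPad? (Fin.suc Fin.zero)) (allFin n))
      ≤⟨ ℕ.+-mono-≤ (sum-𝟙≤1 (onPad? Fin.zero) (allFin⁺ n) (onPad-unique Fin.zero))
                     (sum-𝟙≤1 (onPad? (Fin.suc Fin.zero)) (allFin⁺ n) (onPad-unique (Fin.suc Fin.zero))) ⟩
    2 ∎
    where
    open ℕ.≤-Reasoning
    Occupied : Fin n → Set
    Occupied j = l j ≤ z × z < l j + toℚ (p j)
    occupied? : ∀ j → Dec (Occupied j)
    occupied? j = (l j ≤? z) ×-dec (z <? l j + toℚ (p j))
    onPad? : ∀ q j → Dec (pad j ≡ q × Occupied j)
    onPad? q j = (pad j Fin.≟ q) ×-dec occupied? j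
    onPad-unique : ∀ q {i j} → pad i ≡ q × Occupied i → pad j ≡ q × Occupied j → i ≡ j
    onPad-unique q {i} {j} (refl , li≤z , z<ri) (pj≡pi , lj≤z , z<rj) with i Fin.≟ j
    ... | yes i≡j = i≡j
    ... | no i≢j with disjoint i j i≢j (sym pj≡pi)
    ...   | inj₁ ri≤lj = contradiction (<-≤-trans z<ri (≤-trans ri≤lj lj≤z)) (<-irrefl refl)
    ...   | inj₂ rj≤li = contradiction (<-≤-trans z<rj (≤-trans rj≤li li≤z)) (<-irrefl refl)

reclaimOrder-++ : ∀ {n} (ps qs : List (Piece n)) → reclaimOrder (ps ++ qs) ≡ reclaimOrder ps ++ reclaimOrder qs
reclaimOrder-++ [] qs = refl
reclaimOrder-++ (wait _ ∷ ps) qs = reclaimOrder-++ ps qs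
reclaimOrder-++ (travel _ _ ∷ ps) qs = reclaimOrder-++ ps qs
reclaimOrder-++ (reclaim j _ ∷ ps) qs = cong (j ∷_) (reclaimOrder-++ ps qs)

module Schedule {n L : ℕ} {p : Fin n → ℕ} (pl : Placement n L p) (s : ℚ) where
  open Placement pl

  move : ℚ → Piece n → ℚ
  move x (wait _) = x
  move x (travel up d) = x + s * d
  move x (travel down d) = x - s * d
  move x (reclaim j up) = x + toℚ (p j)
  move x (reclaim j down) = x - toℚ (p j)

  final : ℚ → List (Piece n) → ℚ
  final = foldl move

  positions : ℚ → List (Piece n) → List ℚ
  positions = scanl move

  moves reclaimSegments travelSegments : ℚ → List (Piece n) → List Segment
  moves x [] = []
  moves x (pc ∷ ps) = (x , move x pc) ∷ moves (move x pc) ps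

  reclaimSegments x [] = []
  reclaimSegments x (wait _ ∷ ps) = reclaimSegments x ps
  reclaimSegments x (pc@(travel _ _) ∷ ps) = reclaimSegments (move x pc) ps
  reclaimSegments x (pc@(reclaim _ _) ∷ ps) = (x , move x pc) ∷ reclaimSegments (move x pc) ps

  travelSegments x [] = []
  travelSegments x (wait _ ∷ ps) = travelSegments x ps
  travelSegments x (pc@(travel _ _) ∷ ps) = (x , move x pc) ∷ travelSegments (move x pc) ps
  travelSegments x (pc@(reclaim _ _) ∷ ps) = travelSegments (move x pc) ps

  travelTime waitTime : List (Piece n) → ℚ
  travelTime [] = 0ℚ
  travelTime (travel _ d ∷ ps) = d + travelTime ps
  travelTime (_ ∷ ps) = travelTime ps

  waitTime [] = 0ℚ
  waitTime (wait d ∷ ps) = d + waitTime ps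
  waitTime (_ ∷ ps) = waitTime ps

  reclaimed : List (Piece n) → ℕ
  reclaimed ps = sum (map p (reclaimOrder ps))

  makespan≡ : ∀ ps → makespan p ps ≡ (toℚ (reclaimed ps) + travelTime ps) + waitTime ps
  makespan≡ [] = refl
  makespan≡ (wait d ∷ ps) = trans (cong (d +_) (makespan≡ ps))
    (solve 4 (λ d a b c → d :+ ((a :+ b) :+ c) := (a :+ b) :+ (d :+ c)) refl d (toℚ (reclaimed ps)) (travelTime ps) (waitTime ps))
  makespan≡ (travel _ d ∷ ps) = trans (cong (d +_) (makespan≡ ps))
    (solve 4 (λ d a b c → d :+ ((a :+ b) :+ c) := (a :+ (d :+ b)) :+ c) refl d (toℚ (reclaimed ps)) (travelTime ps) (waitTime ps))
  makespan≡ (reclaim j dir ∷ ps) = begin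
    toℚ (p j) + makespan p ps
      ≡⟨ cong (toℚ (p j) +_) (makespan≡ ps) ⟩
    toℚ (p j) + ((toℚ (reclaimed ps) + travelTime ps) + waitTime ps)
      ≡⟨ solve 4 (λ d a b c → d :+ ((a :+ b) :+ c) := ((d :+ a) :+ b) :+ c) refl
           (toℚ (p j)) (toℚ (reclaimed ps)) (travelTime ps) (waitTime ps) ⟩
    ((toℚ (p j) + toℚ (reclaimed ps)) + travelTime ps) + waitTime ps
      ≡⟨ cong (λ t → (t + travelTime ps) + waitTime ps) (toℚ-+ (p j) (reclaimed ps)) ⟨
    (toℚ (reclaimed (reclaim j dir ∷ ps)) + travelTime ps) + waitTime ps ∎
    where open ≡-Reasoning

  waitTime-nonneg : ∀ {x} ps → Feasible pl s x ps → 0ℚ ≤ waitTime ps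
  waitTime-nonneg [] _ = ≤-refl
  waitTime-nonneg (wait d ∷ ps) (0≤d , f) = +-mono-≤ 0≤d (waitTime-nonneg ps f)
  waitTime-nonneg (travel up d ∷ ps) (_ , _ , f) = waitTime-nonneg ps f
  waitTime-nonneg (travel down d ∷ ps) (_ , _ , f) = waitTime-nonneg ps f
  waitTime-nonneg (reclaim j up ∷ ps) (_ , f) = waitTime-nonneg ps f
  waitTime-nonneg (reclaim j down ∷ ps) (_ , f) = waitTime-nonneg ps f

  final-feasible : ∀ {x} ps → Feasible pl s x ps → final x ps ≡ 0ℚ
  final-feasible [] x≡0 = x≡0
  final-feasible (wait _ ∷ ps) (_ , f) = final-feasible ps f
  final-feasible (travel up _ ∷ ps) (_ , _ , f) = final-feasible ps f
  final-feasible (travel down _ ∷ ps) (_ , _ , f) = final-feasible ps f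
  final-feasible (reclaim _ up ∷ ps) (_ , f) = final-feasible ps f
  final-feasible (reclaim _ down ∷ ps) (_ , f) = final-feasible ps f

  moves-++ : ∀ x ps qs → moves x (ps ++ qs) ≡ moves x ps ++ moves (final x ps) qs
  moves-++ x [] qs = refl
  moves-++ x (pc ∷ ps) qs = cong ((x , move x pc) ∷_) (moves-++ (move x pc) ps qs)

  reclaimSegments-++ : ∀ x ps qs → reclaimSegments x (ps ++ qs) ≡ reclaimSegments x ps ++ reclaimSegments (final x ps) qs
  reclaimSegments-++ x [] qs = refl
  reclaimSegments-++ x (wait _ ∷ ps) qs = reclaimSegments-++ x ps qs
  reclaimSegments-++ x (pc@(travel _ _) ∷ ps) qs = reclaimSegments-++ (move x pc) ps qs
  reclaimSegments-++ x (pc@(reclaim _ _) ∷ ps) qs = cong ((x , move x pc) ∷_) (reclaimSegments-++ (move x pc) ps qs)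

  travelSegments-++ : ∀ x ps qs → travelSegments x (ps ++ qs) ≡ travelSegments x ps ++ travelSegments (final x ps) qs
  travelSegments-++ x [] qs = refl
  travelSegments-++ x (wait _ ∷ ps) qs = travelSegments-++ x ps qs
  travelSegments-++ x (pc@(travel _ _) ∷ ps) qs = cong ((x , move x pc) ∷_) (travelSegments-++ (move x pc) ps qs)
  travelSegments-++ x (pc@(reclaim _ _) ∷ ps) qs = travelSegments-++ (move x pc) ps qs

  totalLength-reclaimSegments : ∀ x ps → totalLength (reclaimSegments x ps) ≡ toℚ (reclaimed ps)
  totalLength-reclaimSegments x [] = refl
  totalLength-reclaimSegments x (wait _ ∷ ps) = totalLength-reclaimSegments x ps
  totalLength-reclaimSegments x (travel _ _ ∷ ps) = totalLength-reclaimSegments _ ps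
  totalLength-reclaimSegments x (reclaim j up ∷ ps) =
    trans (cong₂ _+_ (segLength-ascending x (0≤toℚ (p j))) (totalLength-reclaimSegments _ ps)) (sym (toℚ-+ (p j) (reclaimed ps)))
  totalLength-reclaimSegments x (reclaim j down ∷ ps) =
    trans (cong₂ _+_ (segLength-descending x (0≤toℚ (p j))) (totalLength-reclaimSegments _ ps)) (sym (toℚ-+ (p j) (reclaimed ps)))

  crossings-reclaimSegments : ∀ {x} ps z → Feasible pl s x ps →
                              crossings (reclaimSegments x ps) z ≡ sum (map (occupies pl z) (reclaimOrder ps))
  crossings-reclaimSegments [] z _ = refl
  crossings-reclaimSegments (wait _ ∷ ps) z (_ , f) = crossings-reclaimSegments ps z f
  crossings-reclaimSegments (travel up _ ∷ ps) z (_ , _ , f) = crossings-reclaimSegments ps z f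
  crossings-reclaimSegments (travel down _ ∷ ps) z (_ , _ , f) = crossings-reclaimSegments ps z f
  crossings-reclaimSegments (reclaim j up ∷ ps) z (refl , f) =
    cong₂ ℕ._+_ (trans (cong (occupies pl z j ℕ.+_) (between-empty _ (l j) z (p≤p+q (l j) (0≤toℚ (p j))))) (ℕ.+-identityʳ _))
                (crossings-reclaimSegments ps z f)
  crossings-reclaimSegments (reclaim j down ∷ ps) z (refl , f) =
    cong₂ ℕ._+_ (cong₂ ℕ._+_ (between-empty (l j + toℚ (p j)) _ z (p-q≤p (l j + toℚ (p j)) (0≤toℚ (p j))))
                              (cong (λ y → between y (l j + toℚ (p j)) z) (p+q-q≡p (l j) (toℚ (p j)))))
                (crossings-reclaimSegments ps z f)

  crossings-moves : ∀ x ps z → crossings (moves x ps) z ≡ crossings (reclaimSegments x ps) z ℕ.+ crossings (travelSegments x ps) z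
  crossings-moves x [] z = refl
  crossings-moves x (wait _ ∷ ps) z =
    cong₂ ℕ._+_ (cong₂ ℕ._+_ (between-empty x x z ≤-refl) (between-empty x x z ≤-refl)) (crossings-moves x ps z)
  crossings-moves x (pc@(travel _ _) ∷ ps) z =
    trans (cong (covers (x , y) z ℕ.+_) (crossings-moves y ps z))
          (x∙yz≈y∙xz (covers (x , y) z) (crossings (reclaimSegments y ps) z) (crossings (travelSegments y ps) z))
    where y = move x pc
  crossings-moves x (pc@(reclaim _ _) ∷ ps) z =
    trans (cong (covers (x , y) z ℕ.+_) (crossings-moves y ps z))
          (sym (ℕ.+-assoc (covers (x , y) z) (crossings (reclaimSegments y ps) z) (crossings (travelSegments y ps) z)))
    where y = move x pc

  upCrossings-telescope : ∀ x ps z →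
    upCrossings (moves x ps) z ℕ.+ 𝟙 (z <? x) ≡ downCrossings (moves x ps) z ℕ.+ 𝟙 (z <? final x ps)
  upCrossings-telescope x [] z = refl
  upCrossings-telescope x (pc ∷ ps) z =
    +-telescope (upCross (x , move x pc) z) (downCross (x , move x pc) z) _ _
                (segment-balance x (move x pc) z) (upCrossings-telescope (move x pc) ps z)

  crossings-ascending : ∀ {x} ps {z} → ¬ z < x → z < final x ps → Odd (crossings (moves x ps) z)
  crossings-ascending {x} ps {z} z≮x z<y =
    subst Odd (trans (ℕ.+-comm D U) (sym (crossings≡up+down (moves x ps) z))) (odd-sum D+1≡U+0)
    where
    U = upCrossings (moves x ps) z
    D = downCrossings (moves x ps) z
    D+1≡U+0 : D ℕ.+ 1 ≡ U ℕ.+ 0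
    D+1≡U+0 = sym (begin
      U ℕ.+ 0                    ≡⟨ cong (U ℕ.+_) (𝟙-no (z <? x) z≮x) ⟨
      U ℕ.+ 𝟙 (z <? x)           ≡⟨ upCrossings-telescope x ps z ⟩
      D ℕ.+ 𝟙 (z <? final x ps)  ≡⟨ cong (D ℕ.+_) (𝟙-yes (z <? final x ps) z<y) ⟩
      D ℕ.+ 1                    ∎)
      where open ≡-Reasoning

  crossings-descending : ∀ {x} ps {z} → z < x → ¬ z < final x ps → Odd (crossings (moves x ps) z)
  crossings-descending {x} ps {z} z<x z≮y =
    subst Odd (sym (crossings≡up+down (moves x ps) z)) (odd-sum U+1≡D+0)
    where
    U = upCrossings (moves x ps) z
    D = downCrossings (moves x ps) z
    U+1≡D+0 : U ℕ.+ 1 ≡ D ℕ.+ 0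
    U+1≡D+0 = begin
      U ℕ.+ 1                    ≡⟨ cong (U ℕ.+_) (𝟙-yes (z <? x) z<x) ⟨
      U ℕ.+ 𝟙 (z <? x)           ≡⟨ upCrossings-telescope x ps z ⟩
      D ℕ.+ 𝟙 (z <? final x ps)  ≡⟨ cong (D ℕ.+_) (𝟙-no (z <? final x ps) z≮y) ⟩
      D ℕ.+ 0                    ∎
      where open ≡-Reasoning

  All-positions-head : ∀ {R : ℚ → Set} {x} ps → All R (positions x ps) → R x
  All-positions-head [] (Rx ∷ _) = Rx
  All-positions-head (_ ∷ _) (Rx ∷ _) = Rx

  moves-within : ∀ {R : ℚ → Set} x ps → All R (positions x ps) → All (λ (u , v) → R u × R v) (moves x ps)
  moves-within x [] _ = []
  moves-within x (pc ∷ ps) (Rx ∷ R-rest) = (Rx , All-positions-head ps R-rest) ∷ moves-within (move x pc) ps R-rest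

  splitAtMax : ∀ x ps → ∃₂ λ a b → ps ≡ a ++ b × All (_≤ final x a) (positions x ps)
  splitAtMax x [] = [] , [] , refl , ≤-refl ∷ []
  splitAtMax x (pc ∷ ps) with splitAtMax (move x pc) ps
  ... | a , b , refl , below with x ≤? final (move x pc) a
  ...   | yes x≤M = pc ∷ a , b , refl , x≤M ∷ below
  ...   | no x≰M = [] , pc ∷ a ++ b , refl , ≤-refl ∷ All.map (λ y≤M → ≤-trans y≤M (<⇒≤ (≰⇒> x≰M))) below

  module _ (0≤s : 0ℚ ≤ s) where

    0≤s*d : ∀ {d} → 0ℚ ≤ d → 0ℚ ≤ s * d
    0≤s*d {d} 0≤d = nonNegative⁻¹ (s * d) {{nonNeg*nonNeg⇒nonNeg s {{nonNegative 0≤s}} d {{nonNegative 0≤d}}}}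

    totalLength-travelSegments : ∀ {x} ps → Feasible pl s x ps → totalLength (travelSegments x ps) ≡ s * travelTime ps
    totalLength-travelSegments [] _ = sym (*-zeroʳ s)
    totalLength-travelSegments (wait _ ∷ ps) (_ , f) = totalLength-travelSegments ps f
    totalLength-travelSegments {x} (travel up d ∷ ps) (0≤d , _ , f) =
      trans (cong₂ _+_ (segLength-ascending x (0≤s*d 0≤d)) (totalLength-travelSegments ps f))
            (sym (*-distribˡ-+ s d (travelTime ps)))
    totalLength-travelSegments {x} (travel down d ∷ ps) (0≤d , _ , f) =
      trans (cong₂ _+_ (segLength-descending x (0≤s*d 0≤d)) (totalLength-travelSegments ps f))
            (sym (*-distribˡ-+ s d (travelTime ps)))
    totalLength-travelSegments (reclaim j up ∷ ps) (_ , f) = totalLength-travelSegments ps f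
    totalLength-travelSegments (reclaim j down ∷ ps) (_ , f) = totalLength-travelSegments ps f

    positions-nonneg : ∀ {x} ps → Feasible pl s x ps → 0ℚ ≤ x → All (0ℚ ≤_) (positions x ps)
    positions-nonneg [] _ 0≤x = 0≤x ∷ []
    positions-nonneg (wait _ ∷ ps) (_ , f) 0≤x = 0≤x ∷ positions-nonneg ps f 0≤x
    positions-nonneg {x} (travel up d ∷ ps) (0≤d , _ , f) 0≤x =
      0≤x ∷ positions-nonneg ps f (≤-trans 0≤x (p≤p+q x (0≤s*d 0≤d)))
    positions-nonneg (travel down d ∷ ps) (_ , 0≤x-sd , f) 0≤x = 0≤x ∷ positions-nonneg ps f 0≤x-sd
    positions-nonneg (reclaim j up ∷ ps) (refl , f) 0≤x =
      0≤x ∷ positions-nonneg ps f (≤-trans 0≤x (p≤p+q (l j) (0≤toℚ (p j))))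
    positions-nonneg (reclaim j down ∷ ps) (refl , f) 0≤x =
      0≤x ∷ positions-nonneg ps f (subst (0ℚ ≤_) (sym (p+q-q≡p (l j) (toℚ (p j)))) (l≥0 j))

module Balance {n L : ℕ} {p : Fin n → ℕ} (pl : Placement n L p) {s : ℚ} (0≤s : 0ℚ ≤ s)
               (a b : List (Piece n)) (feasible : Feasible pl s 0ℚ (a ++ b))
               (belowMax : All (_≤ Schedule.final pl s 0ℚ a) (Schedule.positions pl s 0ℚ (a ++ b)))
               (order : reclaimOrder (a ++ b) ≡ allFin n) where
  open Schedule pl s

  M : ℚ
  M = final 0ℚ a

  r₁ r₂ t₁ t₂ T : List Segment
  r₁ = reclaimSegments 0ℚ a
  r₂ = reclaimSegments M b
  t₁ = travelSegments 0ℚ a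
  t₂ = travelSegments M b
  T = travelSegments 0ℚ (a ++ b)

  crossings-T : ∀ z → crossings T z ≡ crossings t₁ z ℕ.+ crossings t₂ z
  crossings-T z = trans (cong (λ gs → crossings gs z) (travelSegments-++ 0ℚ a b)) (crossings-++ t₁ t₂ z)

  reclaims≤2 : ∀ z → crossings r₁ z ℕ.+ crossings r₂ z ℕ.≤ 2
  reclaims≤2 z = subst (ℕ._≤ 2) occupancy≡ (occupancy≤2 pl z)
    where
    occupancy≡ : sum (map (occupies pl z) (allFin n)) ≡ crossings r₁ z ℕ.+ crossings r₂ z
    occupancy≡ = begin
      sum (map (occupies pl z) (allFin n))                ≡⟨ cong (λ js → sum (map (occupies pl z) js)) order ⟨
      sum (map (occupies pl z) (reclaimOrder (a ++ b)))   ≡⟨ crossings-reclaimSegments (a ++ b) z feasible ⟨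
      crossings (reclaimSegments 0ℚ (a ++ b)) z           ≡⟨ cong (λ gs → crossings gs z) (reclaimSegments-++ 0ℚ a b) ⟩
      crossings (r₁ ++ r₂) z                              ≡⟨ crossings-++ r₁ r₂ z ⟩
      crossings r₁ z ℕ.+ crossings r₂ z                   ∎
      where open ≡-Reasoning

  final≡0 : final M b ≡ 0ℚ
  final≡0 = trans (sym (foldl-++ move 0ℚ a b)) (final-feasible (a ++ b) feasible)

  moves-within-[0,M] : All (λ (u , v) → Within 0ℚ M u × Within 0ℚ M v) (moves 0ℚ a ++ moves M b)
  moves-within-[0,M] = subst (All _) (moves-++ 0ℚ a b)
    (moves-within 0ℚ (a ++ b) (All.zip (positions-nonneg 0≤s (a ++ b) feasible ≤-refl , belowMax)))

  ReclaimBound : ℚ → Set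
  ReclaimBound z = crossings r₁ z ℕ.≤ (crossings t₁ z ℕ.+ crossings t₂ z) ℕ.+ crossings r₂ z
                 × crossings r₂ z ℕ.≤ (crossings t₁ z ℕ.+ crossings t₂ z) ℕ.+ crossings r₁ z

  reclaimBound-outside : ∀ {z} → z < 0ℚ ⊎ M ≤ z → ReclaimBound z
  reclaimBound-outside {z} z-out =
      subst (ℕ._≤ (crossings t₁ z ℕ.+ crossings t₂ z) ℕ.+ crossings r₂ z) (sym r₁≡0) z≤n
    , subst (ℕ._≤ (crossings t₁ z ℕ.+ crossings t₂ z) ℕ.+ crossings r₁ z) (sym r₂≡0) z≤n
    where
    r₁≡0 = ℕ.m+n≡0⇒m≡0 _ (trans (sym (crossings-moves 0ℚ a z))
                                  (crossings-outside (moves 0ℚ a) (++⁻ˡ (moves 0ℚ a) moves-within-[0,M]) z-out))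
    r₂≡0 = ℕ.m+n≡0⇒m≡0 _ (trans (sym (crossings-moves M b z))
                                  (crossings-outside (moves M b) (++⁻ʳ (moves 0ℚ a) moves-within-[0,M]) z-out))

  reclaimBound : ∀ z → ReclaimBound z
  reclaimBound z with z <? 0ℚ | z <? M
  ... | yes z<0 | _ = reclaimBound-outside {z} (inj₁ z<0)
  ... | no _ | no z≮M = reclaimBound-outside {z} (inj₂ (≮⇒≥ z≮M))
  ... | no z≮0 | yes z<M =
      crossing-bound (crossings r₁ z) (crossings r₂ z) (reclaims≤2 z) odd₁ odd₂
    , subst (λ t → crossings r₂ z ℕ.≤ t ℕ.+ crossings r₁ z) (ℕ.+-comm (crossings t₂ z) (crossings t₁ z))
        (crossing-bound (crossings r₂ z) (crossings r₁ z)
                        (subst (ℕ._≤ 2) (ℕ.+-comm (crossings r₁ z) _) (reclaims≤2 z)) odd₂ odd₁)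
    where
    odd₁ = subst Odd (crossings-moves 0ℚ a z) (crossings-ascending a z≮0 z<M)
    odd₂ = subst Odd (crossings-moves M b z) (crossings-descending b z<M (subst (λ y → ¬ z < y) (sym final≡0) z≮0))

  balance : toℚ (reclaimed a) ≤ s * travelTime (a ++ b) + toℚ (reclaimed b)
          × toℚ (reclaimed b) ≤ s * travelTime (a ++ b) + toℚ (reclaimed a)
  balance = lengths r₁ r₂ (totalLength-≤-+ r₁ T r₂ (λ z → viaT {z} (proj₁ (reclaimBound z))))
                    (totalLength-reclaimSegments 0ℚ a) (totalLength-reclaimSegments M b)
          , lengths r₂ r₁ (totalLength-≤-+ r₂ T r₁ (λ z → viaT {z} (proj₂ (reclaimBound z))))
                    (totalLength-reclaimSegments M b) (totalLength-reclaimSegments 0ℚ a)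
    where
    viaT : ∀ {z x y} → x ℕ.≤ (crossings t₁ z ℕ.+ crossings t₂ z) ℕ.+ y → x ℕ.≤ crossings T z ℕ.+ y
    viaT {z} {x} {y} = subst (λ t → x ℕ.≤ t ℕ.+ y) (sym (crossings-T z))
    lengths : ∀ gs hs {x y} → totalLength gs ≤ totalLength T + totalLength hs →
              totalLength gs ≡ x → totalLength hs ≡ y → x ≤ s * travelTime (a ++ b) + y
    lengths _ _ gs≤ refl refl = subst (λ t → _ ≤ t + _) (totalLength-travelSegments 0≤s (a ++ b) feasible) gs≤

take-length-++ : ∀ {A : Set} (xs ys : List A) → take (length xs) (xs ++ ys) ≡ xs
take-length-++ [] ys = refl
take-length-++ (x ∷ xs) ys = cong (x ∷_) (take-length-++ xs ys)

drop-length-++ : ∀ {A : Set} (xs ys : List A) → drop (length xs) (xs ++ ys) ≡ ys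
drop-length-++ [] ys = refl
drop-length-++ (x ∷ xs) ys = drop-length-++ xs ys

foldr-⊓-≤ : ∀ (g : ℕ → ℕ) {k} xs → k ∈ xs → foldr (λ i acc → g i ℕ.⊓ acc) (g 0) xs ℕ.≤ g k
foldr-⊓-≤ g (x ∷ xs) (here refl) = ℕ.m⊓n≤m (g x) _
foldr-⊓-≤ g (x ∷ xs) (there k∈xs) = ℕ.≤-trans (ℕ.m⊓n≤n (g x) _) (foldr-⊓-≤ g xs k∈xs)

minGap-≤ : ∀ {n} (p : Fin n → ℕ) xs ys → xs ++ ys ≡ allFin n → minGap n p ℕ.≤ ℕ.∣ sum (map p xs) - sum (map p ys) ∣
minGap-≤ {n} p xs ys xs++ys≡all =
  subst (minGap n p ℕ.≤_) (cong₂ ℕ.∣_-_∣ Pre≡ Suf≡)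
    (foldr-⊓-≤ (λ i → ℕ.∣ Pre n p i - Suf n p i ∣) (upTo (suc n)) (∈-upTo⁺ (s≤s k≤n)))
  where
  k = length (map p xs)
  split : map p (allFin n) ≡ map p xs ++ map p ys
  split = trans (cong (map p) (sym xs++ys≡all)) (map-++ p xs ys)
  Pre≡ : Pre n p k ≡ sum (map p xs)
  Pre≡ = cong sum (trans (cong (take k) split) (take-length-++ (map p xs) (map p ys)))
  Suf≡ : Suf n p k ≡ sum (map p ys)
  Suf≡ = cong sum (trans (cong (drop k) split) (drop-length-++ (map p xs) (map p ys)))
  k≤n : k ℕ.≤ n
  k≤n = subst (k ℕ.≤_) (trans (cong length (sym split)) (trans (length-map p (allFin n)) (length-tabulate (λ i → i))))
          (length-++-≤ˡ (map p xs))

lemma16 : (n L : ℕ) → 0 ℕ.< L → (p : Fin n → ℕ) →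
          (∀ j → 0 ℕ.< p j) → (∀ j → p j ℕ.≤ L) →
          (s : ℚ) → 1ℚ ≤ s → .{{_ : NonZero s}} →
          (pl : Placement n L p) → (sched : List (Piece n)) →
          Feasible pl s 0ℚ sched →
          reclaimOrder sched ≡ allFin n →
          toℚ (Ptot n p) + (toℚ (minGap n p) ÷ s) ≤ makespan p sched
lemma16 n L _ p _ _ s 1≤s pl sched feasible order with Schedule.splitAtMax pl s 0ℚ sched
... | a , b , refl , belowMax = begin
  toℚ (Ptot n p) + (toℚ (minGap n p) ÷ s)                     ≤⟨ +-monoʳ-≤ (toℚ (Ptot n p)) (÷-≤ s 0<s gap≤travel) ⟩
  toℚ (Ptot n p) + travelTime (a ++ b)                        ≤⟨ p≤p+q _ (waitTime-nonneg (a ++ b) feasible) ⟩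
  (toℚ (Ptot n p) + travelTime (a ++ b)) + waitTime (a ++ b)
    ≡⟨ cong (λ js → (toℚ (sum (map p js)) + travelTime (a ++ b)) + waitTime (a ++ b)) order ⟨
  (toℚ (reclaimed (a ++ b)) + travelTime (a ++ b)) + waitTime (a ++ b)
    ≡⟨ makespan≡ (a ++ b) ⟨
  makespan p (a ++ b)                                         ∎
  where
  open ≤-Reasoning
  open Schedule pl s
  0<s : 0ℚ < s
  0<s = <-≤-trans (positive⁻¹ 1ℚ) 1≤s
  open Balance pl (<⇒≤ 0<s) a b feasible belowMax order
  gap≤travel : toℚ (minGap n p) ≤ s * travelTime (a ++ b)
  gap≤travel = ≤-trans (toℚ-mono-≤ (minGap-≤ p (reclaimOrder a) (reclaimOrder b) (trans (sym (reclaimOrder-++ a b)) order)))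
                       (toℚ-∣-∣≤ {reclaimed a} {reclaimed b} (proj₁ balance) (proj₂ balance))
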